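{- Let $\Bbbk$ be a totally ordered division ring, let $\Omega$ be a convex subset of a right vector space $\mathbb{E}$ over $\Bbbk$, and let $\mathcal{F}\cup\{a\}$ be a set of affine functionals on $\mathbb{E}$. Set $A^+=\{x\in\Omega: a(x)>0\}$ and $A^-=\{x\in\Omega:a(x)<0\}$. Then for every $U\in\mathrm{Bool}(\mathcal{F},\Omega)$ with $U\subseteq A^+\cup A^-$, there are $U^+,U^-\in\mathrm{Bool}(\mathcal{F},\Omega)$ such that $U=U^+\cup U^-$, $U^+\subseteq A^+$ and $U^-\subseteq A^-$.
   Context: An affine functional on $\mathbb{E}$ is a map $f\colon\mathbb{E}\to\Bbbk$ such that $f-f(0)$ is linear (i.e. additive with $f(x\lambda)=f(x)\lambda$). $\mathrm{Bool}(\mathcal{F},\Omega)$ is the Boolean subalgebra of the powerset of $\Omega$ generated by all sets $\{x\in\Omega:f(x)>0\}$ and $\{x\in\Omega: f(x)<0\}$ for $f\in\mathcal{F}$. -}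

module Defs where

open import Level using (Level; _⊔_) renaming (suc to lsuc)
open import Data.Empty using (⊥)
open import Data.Product using (_×_; Σ; ∃)
open import Data.Sum using (_⊎_)
open import Relation.Nullary using (¬_)
open import Relation.Binary.PropositionalEquality using (_≡_; _≢_)
open import Relation.Binary.Structures using (IsTotalOrder)
open import Algebra.Structures using (IsRing; IsAbelianGroup)

record TotallyOrderedDivisionRing (ℓ : Level) : Set (lsuc ℓ) where
  infixl 7 _*_
  infixl 6 _+_
  infix  4 _≤_ _<_
  field
    Carrier : Set ℓ
    _+_ _*_ : Carrier → Carrier → Carrier
    -_      : Carrier → Carrier
    0# 1#   : Carrier
    isRing  : IsRing _≡_ _+_ _*_ -_ 0# 1#
    0≢1     : 0# ≢ 1#
    inverse : ∀ x → x ≢ 0# → Σ Carrier (λ y → (x * y ≡ 1#) × (y * x ≡ 1#))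
    _≤_     : Carrier → Carrier → Set ℓ
    isTotalOrder : IsTotalOrder _≡_ _≤_
    +-mono-≤ : ∀ {x y} z → x ≤ y → x + z ≤ y + z
    *-nonneg : ∀ {x y} → 0# ≤ x → 0# ≤ y → 0# ≤ x * y

  _<_ : Carrier → Carrier → Set ℓ
  x < y = (x ≤ y) × (x ≢ y)

  _-_ : Carrier → Carrier → Carrier
  x - y = x + (- y)

record RightVectorSpace {ℓ : Level} (𝕜 : TotallyOrderedDivisionRing ℓ) : Set (lsuc ℓ) where
  open TotallyOrderedDivisionRing 𝕜 using (Carrier) renaming (_+_ to _+ₖ_; _*_ to _*ₖ_; 1# to 1ₖ)
  infixl 7 _·_
  infixl 6 _+ᵥ_
  field
    Vec    : Set ℓ
    _+ᵥ_   : Vec → Vec → Vec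
    -ᵥ_    : Vec → Vec
    0ᵥ     : Vec
    isAbelianGroup : IsAbelianGroup _≡_ _+ᵥ_ 0ᵥ -ᵥ_
    _·_    : Vec → Carrier → Vec
    ·-distribˡ : ∀ x y c → (x +ᵥ y) · c ≡ x · c +ᵥ y · c
    ·-distribʳ : ∀ x c d → x · (c +ₖ d) ≡ x · c +ᵥ x · d
    ·-assoc    : ∀ x c d → (x · c) · d ≡ x · (c *ₖ d)
    ·-identity : ∀ x → x · 1ₖ ≡ x

module _ {ℓ : Level} {𝕜 : TotallyOrderedDivisionRing ℓ} (𝔼 : RightVectorSpace 𝕜) where
  open TotallyOrderedDivisionRing 𝕜
  open RightVectorSpace 𝔼

  IsConvex : (Vec → Set ℓ) → Set ℓ
  IsConvex Ω = ∀ x y t → Ω x → Ω y → 0# ≤ t → t ≤ 1# → Ω (x · (1# - t) +ᵥ y · t)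

  IsLinear : (Vec → Carrier) → Set ℓ
  IsLinear g = (∀ x y → g (x +ᵥ y) ≡ g x + g y) × (∀ x c → g (x · c) ≡ g x * c)

  IsAffine : (Vec → Carrier) → Set ℓ
  IsAffine f = IsLinear (λ x → f x - f 0ᵥ)

  data BoolExpr (I : Set ℓ) : Set ℓ where
    pos neg : I → BoolExpr I
    empty   : BoolExpr I
    compl   : BoolExpr I → BoolExpr I
    union inter : BoolExpr I → BoolExpr I → BoolExpr I

  ⟦_⟧ : {I : Set ℓ} → BoolExpr I → (I → Vec → Carrier) → (Vec → Set ℓ) → Vec → Set ℓ
  ⟦ pos i ⟧ F Ω x = Ω x × (0# < F i x)
  ⟦ neg i ⟧ F Ω x = Ω x × (F i x < 0#)
  ⟦ empty ⟧ F Ω x = Level.Lift ℓ ⊥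
  ⟦ compl e ⟧ F Ω x = Ω x × ¬ (⟦ e ⟧ F Ω x)
  ⟦ union e₁ e₂ ⟧ F Ω x = ⟦ e₁ ⟧ F Ω x ⊎ ⟦ e₂ ⟧ F Ω x
  ⟦ inter e₁ e₂ ⟧ F Ω x = ⟦ e₁ ⟧ F Ω x × ⟦ e₂ ⟧ F Ω x

  _≐_ : (Vec → Set ℓ) → (Vec → Set ℓ) → Set ℓ
  U ≐ V = ∀ x → (U x → V x) × (V x → U x)

  _⊆_ : (Vec → Set ℓ) → (Vec → Set ℓ) → Set ℓ
  U ⊆ V = ∀ x → U x → V x

  _∪_ : (Vec → Set ℓ) → (Vec → Set ℓ) → Vec → Set ℓ
  (U ∪ V) x = U x ⊎ V x

  -- Membership in Bool(F, Ω): the Boolean subalgebra of 𝒫(Ω) generated by the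
  -- sets {x ∈ Ω : f(x) > 0} and {x ∈ Ω : f(x) < 0}, f ∈ F.
  InBool : {I : Set ℓ} → (I → Vec → Carrier) → (Vec → Set ℓ) → (Vec → Set ℓ) → Set ℓ
  InBool {I} F Ω U = Σ (BoolExpr I) (λ e → U ≐ ⟦ e ⟧ F Ω)

  PosSet NegSet : (Vec → Carrier) → (Vec → Set ℓ) → Vec → Set ℓ
  PosSet a Ω x = Ω x × (0# < a x)
  NegSet a Ω x = Ω x × (a x < 0#)

{-# OPTIONS --safe #-}
-- An element of Bool(F, Ω) only sees the signs of the finitely many functionals occurring in an
-- expression for it.  Sorting the points of Ω by these signs cuts Ω into finitely many atoms, each
-- the intersection of Ω with open half-spaces and hyperplanes, hence convex, and U is a union of
-- atoms.  On an atom inside U the affine functional a has no zero, so, by the intermediate value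
-- property along segments, a has constant sign there.  Hence U⁺ (resp. U⁻) can be taken to be the
-- union of the atoms meeting U ∩ A⁺ (resp. U ∩ A⁻); excluded middle decides which atoms these are.
module Submission where

open import Level using (Level)
open import Function using (id; _∘_)
open import Data.Product using (_×_; Σ; ∃; _,_; proj₁; proj₂)
open import Data.Sum using (_⊎_; inj₁; inj₂)
open import Data.Empty using (⊥; ⊥-elim)
open import Relation.Nullary using (¬_; yes; no)
open import Relation.Unary using (Decidable)
open import Relation.Binary.PropositionalEquality
  using (_≡_; _≢_; refl; sym; trans; cong; cong₂; subst; subst₂; module ≡-Reasoning)
open import Relation.Binary.Structures using (IsTotalOrder)
open import Algebra.Structures using (IsRing)
open import Algebra.Bundles using (Ring)
open import Axiom.ExcludedMiddle using (ExcludedMiddle)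

open import Data.List using (List; []; _∷_; [_]; _++_; map; filter; cartesianProductWith)
open import Data.List.Membership.Propositional using (_∈_)
open import Data.List.Membership.Propositional.Properties
  using (∈-cartesianProductWith⁺; ∈-filter⁺; ∈-filter⁻)
open import Data.List.Relation.Unary.Any using (here; there)
open import Data.List.Relation.Unary.All using (All; []; _∷_)
import Data.List.Relation.Unary.All as All
import Data.List.Relation.Unary.All.Properties as All
open import Data.List.Relation.Unary.All.Properties using (++⁻ˡ; ++⁻ʳ)

open import Defs

data Sign : Set where
  positive negative zero : Sign

module OrderedDivisionRingProperties {ℓ : Level} (𝕜 : TotallyOrderedDivisionRing ℓ) where
  open TotallyOrderedDivisionRing 𝕜
  open IsRing isRing
    using (+-comm; +-assoc; *-assoc; distribˡ; zeroˡ; zeroʳ; -‿inverseʳ; +-identityˡ; *-identityˡ; *-identityʳ)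
  open IsTotalOrder isTotalOrder using (total; antisym)
  open ≡-Reasoning

  ring : Ring ℓ ℓ
  ring = record { isRing = isRing }

  open import Algebra.Properties.CommutativeSemigroup (Ring.+-commutativeSemigroup ring) using (interchange)
  open import Algebra.Properties.Ring ring
    using (-0#≈0#; -‿involutive; -‿distribˡ-*; -‿+-comm; +-inverseʳ-unique;
           //-rightDividesˡ; //-rightDividesʳ; ⁻¹-anti-homo-//; x∙y⁻¹≈ε⇒x≈y; [y-z]x≈yx-zx; x[y-z]≈xy-xz)

  x≤y⇒0≤y-x : ∀ {x y} → x ≤ y → 0# ≤ y - x
  x≤y⇒0≤y-x {x} {y} x≤y = subst (_≤ y - x) (-‿inverseʳ x) (+-mono-≤ (- x) x≤y)

  0≤y-x⇒x≤y : ∀ {x y} → 0# ≤ y - x → x ≤ y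
  0≤y-x⇒x≤y {x} {y} 0≤y-x = subst₂ _≤_ (+-identityˡ x) (//-rightDividesˡ x y) (+-mono-≤ x 0≤y-x)

  x≤0⇒0≤-x : ∀ {x} → x ≤ 0# → 0# ≤ - x
  x≤0⇒0≤-x {x} x≤0 = subst (0# ≤_) (+-identityˡ (- x)) (x≤y⇒0≤y-x x≤0)

  0≤-x⇒x≤0 : ∀ {x} → 0# ≤ - x → x ≤ 0#
  0≤-x⇒x≤0 {x} 0≤-x = 0≤y-x⇒x≤y (subst (0# ≤_) (sym (+-identityˡ (- x))) 0≤-x)

  x<0⇒0<-x : ∀ {x} → x < 0# → 0# < - x
  x<0⇒0<-x {x} (x≤0 , x≢0) = x≤0⇒0≤-x x≤0 , λ 0≡-x → x≢0 (begin
    x       ≡⟨ -‿involutive x ⟨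
    - - x   ≡⟨ cong -_ 0≡-x ⟨
    - 0#    ≡⟨ -0#≈0# ⟩
    0#      ∎)

  0<-x⇒x<0 : ∀ {x} → 0# < - x → x < 0#
  0<-x⇒x<0 {x} (0≤-x , 0≢-x) = 0≤-x⇒x≤0 0≤-x , λ x≡0 → 0≢-x (sym (trans (cong -_ x≡0) -0#≈0#))

  0<x⇒x≮0 : ∀ {x} → 0# < x → ¬ (x < 0#)
  0<x⇒x≮0 (0≤x , 0≢x) (x≤0 , _) = 0≢x (antisym 0≤x x≤0)

  +-nonneg : ∀ {x y} → 0# ≤ x → 0# ≤ y → 0# ≤ x + y
  +-nonneg {x} {y} 0≤x 0≤y =
    IsTotalOrder.trans isTotalOrder 0≤y (subst (_≤ x + y) (+-identityˡ y) (+-mono-≤ y 0≤x))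

  0≤1 : 0# ≤ 1#
  0≤1 with total 0# 1#
  ... | inj₁ 0≤1 = 0≤1
  ... | inj₂ 1≤0 = subst (0# ≤_) -1*-1≡1 (*-nonneg (x≤0⇒0≤-x 1≤0) (x≤0⇒0≤-x 1≤0))
    where
    -1*-1≡1 : (- 1#) * (- 1#) ≡ 1#
    -1*-1≡1 = trans (sym (-‿distribˡ-* 1# (- 1#))) (trans (cong -_ (*-identityˡ (- 1#))) (-‿involutive 1#))

  nonneg-sum≡0⇒≡0 : ∀ {x y} → 0# ≤ x → 0# ≤ y → x + y ≡ 0# → x ≡ 0#
  nonneg-sum≡0⇒≡0 {x} {y} 0≤x 0≤y x+y≡0 =
    antisym (0≤-x⇒x≤0 (subst (0# ≤_) (+-inverseʳ-unique x y x+y≡0) 0≤y)) 0≤x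

  x*y≡0⇒y≡0 : ∀ {x y} → x ≢ 0# → x * y ≡ 0# → y ≡ 0#
  x*y≡0⇒y≡0 {x} {y} x≢0 xy≡0 with inverse x x≢0
  ... | x⁻¹ , _ , x⁻¹x≡1 = begin
    y             ≡⟨ *-identityˡ y ⟨
    1# * y        ≡⟨ cong (_* y) x⁻¹x≡1 ⟨
    x⁻¹ * x * y   ≡⟨ *-assoc x⁻¹ x y ⟩
    x⁻¹ * (x * y) ≡⟨ cong (x⁻¹ *_) xy≡0 ⟩
    x⁻¹ * 0#      ≡⟨ zeroʳ x⁻¹ ⟩
    0#            ∎

  inverse-nonneg : ∀ {x y} → 0# ≤ x → y * x ≡ 1# → 0# ≤ y
  inverse-nonneg {x} {y} 0≤x yx≡1 with total 0# y
  ... | inj₁ 0≤y = 0≤y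
  ... | inj₂ y≤0 = ⊥-elim (0≢1 (antisym 0≤1 (0≤-x⇒x≤0 0≤-1)))
    where
    0≤-1 : 0# ≤ - 1#
    0≤-1 = subst (0# ≤_) (trans (sym (-‿distribˡ-* y x)) (cong -_ yx≡1)) (*-nonneg (x≤0⇒0≤-x y≤0) 0≤x)

  -- `_-_` has no fixity declaration, so it binds tighter than `_*_` and `_+_`: `p - c * t` is `(p - c) * t`.
  interpolate : Carrier → Carrier → Carrier → Carrier
  interpolate p q t = p * (1# - t) + q * t

  interpolate-translate : ∀ p q c t → interpolate (p - c) (q - c) t + c ≡ interpolate p q t
  interpolate-translate p q c t = begin
    ((p - c) * (1# - t) + (q - c) * t) + c
      ≡⟨ cong (_+ c) (cong₂ _+_ ([y-z]x≈yx-zx (1# - t) p c) ([y-z]x≈yx-zx t q c)) ⟩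
    (((p * (1# - t)) - (c * (1# - t))) + ((q * t) - (c * t))) + c
      ≡⟨ cong (_+ c) (interchange (p * (1# - t)) (- (c * (1# - t))) (q * t) (- (c * t))) ⟩
    (interpolate p q t + (- (c * (1# - t)) + - (c * t))) + c
      ≡⟨ cong (λ u → (interpolate p q t + u) + c) (-‿+-comm (c * (1# - t)) (c * t)) ⟩
    (interpolate p q t - (c * (1# - t) + c * t)) + c
      ≡⟨ cong (λ u → (interpolate p q t - u) + c) (distribˡ c (1# - t) t) ⟨
    (interpolate p q t - (c * ((1# - t) + t))) + c
      ≡⟨ cong (λ u → (interpolate p q t - (c * u)) + c) (//-rightDividesˡ t 1#) ⟩
    (interpolate p q t - (c * 1#)) + c
      ≡⟨ cong (λ u → (interpolate p q t - u) + c) (*-identityʳ c) ⟩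
    (interpolate p q t - c) + c
      ≡⟨ //-rightDividesˡ c (interpolate p q t) ⟩
    interpolate p q t
      ∎

  interpolate-pos : ∀ {p q t} → 0# < p → 0# < q → 0# ≤ t → t ≤ 1# → 0# < interpolate p q t
  interpolate-pos {p} {q} {t} (0≤p , 0≢p) (0≤q , 0≢q) 0≤t t≤1 = +-nonneg 0≤p[1-t] 0≤qt , 0≢sum
    where
    0≤p[1-t] : 0# ≤ p * (1# - t)
    0≤p[1-t] = *-nonneg 0≤p (x≤y⇒0≤y-x t≤1)
    0≤qt : 0# ≤ q * t
    0≤qt = *-nonneg 0≤q 0≤t
    0≢sum : 0# ≢ interpolate p q t
    0≢sum 0≡sum = 0≢1 (begin
      0#             ≡⟨ +-identityˡ 0# ⟨
      0# + 0#        ≡⟨ cong₂ _+_ 1-t≡0 t≡0 ⟨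
      (1# - t) + t   ≡⟨ //-rightDividesˡ t 1# ⟩
      1#             ∎)
      where
      1-t≡0 : 1# - t ≡ 0#
      1-t≡0 = x*y≡0⇒y≡0 (λ p≡0 → 0≢p (sym p≡0)) (nonneg-sum≡0⇒≡0 0≤p[1-t] 0≤qt (sym 0≡sum))
      t≡0 : t ≡ 0#
      t≡0 = x*y≡0⇒y≡0 (λ q≡0 → 0≢q (sym q≡0))
              (nonneg-sum≡0⇒≡0 0≤qt 0≤p[1-t] (trans (+-comm (q * t) (p * (1# - t))) (sym 0≡sum)))

  -‿interpolate : ∀ p q t → interpolate (- p) (- q) t ≡ - interpolate p q t
  -‿interpolate p q t = begin
    (- p) * (1# - t) + (- q) * t     ≡⟨ cong₂ _+_ (-‿distribˡ-* p (1# - t)) (-‿distribˡ-* q t) ⟨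
    - (p * (1# - t)) + - (q * t)     ≡⟨ -‿+-comm (p * (1# - t)) (q * t) ⟩
    - (p * (1# - t) + q * t)         ∎

  interpolate-neg : ∀ {p q t} → p < 0# → q < 0# → 0# ≤ t → t ≤ 1# → interpolate p q t < 0#
  interpolate-neg {p} {q} {t} p<0 q<0 0≤t t≤1 =
    0<-x⇒x<0 (subst (0# <_) (-‿interpolate p q t) (interpolate-pos (x<0⇒0<-x p<0) (x<0⇒0<-x q<0) 0≤t t≤1))

  interpolate-zero : ∀ t → interpolate 0# 0# t ≡ 0#
  interpolate-zero t = trans (cong₂ _+_ (zeroˡ (1# - t)) (zeroˡ t)) (+-identityˡ 0#)

  -- The zero of the segment from p > 0 to q < 0 sits at t = (p - q)⁻¹ p.
  interpolate-root : ∀ {p q} → 0# < p → q < 0# →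
                     ∃ λ t → 0# ≤ t × t ≤ 1# × interpolate p q t ≡ 0#
  interpolate-root {p} {q} (0≤p , 0≢p) q<0 with inverse (p - q) p-q≢0
    where
    p-q≢0 : p - q ≢ 0#
    p-q≢0 p-q≡0 = 0<x⇒x≮0 (0≤p , 0≢p) (subst (_< 0#) (sym (x∙y⁻¹≈ε⇒x≈y p q p-q≡0)) q<0)
  ... | d , [p-q]d≡1 , d[p-q]≡1 = t , 0≤t , t≤1 , root
    where
    0≤-q : 0# ≤ - q
    0≤-q = proj₁ (x<0⇒0<-x q<0)
    0≤d : 0# ≤ d
    0≤d = inverse-nonneg (+-nonneg 0≤p 0≤-q) d[p-q]≡1
    t : Carrier
    t = d * p
    0≤t : 0# ≤ t
    0≤t = *-nonneg 0≤d 0≤p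
    1-t≡d[-q] : 1# - t ≡ d * (- q)
    1-t≡d[-q] = begin
      1# - t                         ≡⟨ cong (_- t) d[p-q]≡1 ⟨
      (d * (p - q)) - t              ≡⟨ cong (_- t) (distribˡ d p (- q)) ⟩
      (d * p + d * (- q)) - t        ≡⟨ cong (_- t) (+-comm (d * p) (d * (- q))) ⟩
      (d * (- q) + t) - t            ≡⟨ //-rightDividesʳ t (d * (- q)) ⟩
      d * (- q)                      ∎
    t≤1 : t ≤ 1#
    t≤1 = 0≤y-x⇒x≤y (subst (0# ≤_) (sym 1-t≡d[-q]) (*-nonneg 0≤d 0≤-q))
    root : interpolate p q t ≡ 0#
    root = begin
      p * (1# - t) + q * t                ≡⟨ cong (_+ q * t) (x[y-z]≈xy-xz p 1# t) ⟩
      ((p * 1#) - (p * t)) + q * t        ≡⟨ +-assoc (p * 1#) (- (p * t)) (q * t) ⟩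
      p * 1# + (- (p * t) + q * t)        ≡⟨ cong₂ _+_ (*-identityʳ p) (+-comm (- (p * t)) (q * t)) ⟩
      p + ((q * t) - (p * t))             ≡⟨ cong (p +_) (⁻¹-anti-homo-// (p * t) (q * t)) ⟨
      p - ((p * t) - (q * t))             ≡⟨ cong (λ u → p - u) ([y-z]x≈yx-zx t p q) ⟨
      p - ((p - q) * (d * p))             ≡⟨ cong (λ u → p - u) (*-assoc (p - q) d p) ⟨
      p - ((p - q) * d * p)               ≡⟨ cong (λ u → p - (u * p)) [p-q]d≡1 ⟩
      p - (1# * p)                        ≡⟨ cong (λ u → p - u) (*-identityˡ p) ⟩
      p - p                               ≡⟨ -‿inverseʳ p ⟩
      0#                                  ∎

  HasSign : Sign → Carrier → Set ℓ
  HasSign positive c = 0# < c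
  HasSign negative c = c < 0#
  HasSign zero     c = c ≡ 0#

  hasSign-unique : ∀ {s s′ c} → HasSign s c → HasSign s′ c → s ≡ s′
  hasSign-unique {positive} {positive} _ _ = refl
  hasSign-unique {positive} {negative} 0<c c<0 = ⊥-elim (0<x⇒x≮0 0<c c<0)
  hasSign-unique {positive} {zero} (_ , 0≢c) c≡0 = ⊥-elim (0≢c (sym c≡0))
  hasSign-unique {negative} {positive} c<0 0<c = ⊥-elim (0<x⇒x≮0 0<c c<0)
  hasSign-unique {negative} {negative} _ _ = refl
  hasSign-unique {negative} {zero} (_ , c≢0) c≡0 = ⊥-elim (c≢0 c≡0)
  hasSign-unique {zero} {positive} c≡0 (_ , 0≢c) = ⊥-elim (0≢c (sym c≡0))
  hasSign-unique {zero} {negative} c≡0 (_ , c≢0) = ⊥-elim (c≢0 c≡0)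
  hasSign-unique {zero} {zero} _ _ = refl

  hasSign-interpolate : ∀ s {p q t} → HasSign s p → HasSign s q → 0# ≤ t → t ≤ 1# →
                        HasSign s (interpolate p q t)
  hasSign-interpolate positive 0<p 0<q = interpolate-pos 0<p 0<q
  hasSign-interpolate negative p<0 q<0 = interpolate-neg p<0 q<0
  hasSign-interpolate zero {t = t} refl refl _ _ = interpolate-zero t

  module Signs (em : ExcludedMiddle ℓ) where

    trichotomy : ∀ c → ∃ λ s → HasSign s c
    trichotomy c with em {c ≡ 0#} | total 0# c
    ... | yes c≡0 | _        = zero , c≡0
    ... | no c≢0  | inj₁ 0≤c = positive , 0≤c , (λ 0≡c → c≢0 (sym 0≡c))
    ... | no c≢0  | inj₂ c≤0 = negative , c≤0 , c≢0

    sign : Carrier → Sign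
    sign c = proj₁ (trichotomy c)

    sign-correct : ∀ c → HasSign (sign c) c
    sign-correct c = proj₂ (trichotomy c)

    sign-unique : ∀ {s c} → HasSign s c → sign c ≡ s
    sign-unique = hasSign-unique (sign-correct _)

    sign-transfer : ∀ s {c d} → sign c ≡ sign d → HasSign s c → HasSign s d
    sign-transfer s {d = d} signc≡signd hasSign =
      subst (λ s → HasSign s d) (trans (sym signc≡signd) (sign-unique hasSign)) (sign-correct d)

    neither-pos-nor-neg⇒zero : ∀ {c} → ¬ (0# < c) → ¬ (c < 0#) → c ≡ 0#
    neither-pos-nor-neg⇒zero {c} c≯0 c≮0 with trichotomy c
    ... | positive , 0<c = ⊥-elim (c≯0 0<c)
    ... | negative , c<0 = ⊥-elim (c≮0 c<0)
    ... | zero     , c≡0 = c≡0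

module AffineFunctionalProperties {ℓ : Level} {𝕜 : TotallyOrderedDivisionRing ℓ} (𝔼 : RightVectorSpace 𝕜) where
  open TotallyOrderedDivisionRing 𝕜
  open RightVectorSpace 𝔼
  open OrderedDivisionRingProperties 𝕜
  open import Algebra.Properties.Ring ring using (//-rightDividesˡ)
  open ≡-Reasoning

  affine-interpolate : ∀ {f} → IsAffine 𝔼 f → ∀ x y t →
                       f (x · (1# - t) +ᵥ y · t) ≡ interpolate (f x) (f y) t
  affine-interpolate {f} (additive , homogeneous) x y t = begin
    f z                                        ≡⟨ //-rightDividesˡ c (f z) ⟨
    (f z - c) + c                              ≡⟨ cong (_+ c) (additive (x · (1# - t)) (y · t)) ⟩
    ((f (x · (1# - t)) - c) + (f (y · t) - c)) + c
      ≡⟨ cong (_+ c) (cong₂ _+_ (homogeneous x (1# - t)) (homogeneous y t)) ⟩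
    interpolate (f x - c) (f y - c) t + c      ≡⟨ interpolate-translate (f x) (f y) c t ⟩
    interpolate (f x) (f y) t                  ∎
    where
    z : Vec
    z = x · (1# - t) +ᵥ y · t
    c : Carrier
    c = f 0ᵥ

  ×-convex : ∀ {P Q} → IsConvex 𝔼 P → IsConvex 𝔼 Q → IsConvex 𝔼 (λ x → P x × Q x)
  ×-convex P-convex Q-convex x y t (Px , Qx) (Py , Qy) 0≤t t≤1 =
    P-convex x y t Px Py 0≤t t≤1 , Q-convex x y t Qx Qy 0≤t t≤1

  signSet-convex : ∀ {Ω f} s → IsConvex 𝔼 Ω → IsAffine 𝔼 f → IsConvex 𝔼 (λ x → Ω x × HasSign s (f x))
  signSet-convex {f = f} s Ω-convex f-affine x y t (Ωx , sx) (Ωy , sy) 0≤t t≤1 =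
    Ω-convex x y t Ωx Ωy 0≤t t≤1 ,
    subst (HasSign s) (sym (affine-interpolate f-affine x y t)) (hasSign-interpolate s sx sy 0≤t t≤1)

  affine-no-sign-change : ∀ {a C} → IsAffine 𝔼 a → IsConvex 𝔼 C → (∀ {z} → C z → a z ≢ 0#) →
                          ∀ {x y} → C x → C y → 0# < a x → a y < 0# → ⊥
  affine-no-sign-change {a} a-affine C-convex a≢0 {x} {y} Cx Cy 0<ax ay<0
    with interpolate-root 0<ax ay<0
  ... | t , 0≤t , t≤1 , root =
    a≢0 (C-convex x y t Cx Cy 0≤t t≤1) (trans (affine-interpolate a-affine x y t) root)

module BoolExprProperties {ℓ : Level} (em : ExcludedMiddle ℓ) {𝕜 : TotallyOrderedDivisionRing ℓ}
                          (𝔼 : RightVectorSpace 𝕜) (Ω : RightVectorSpace.Vec 𝔼 → Set ℓ) {I : Set ℓ}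
                          (F : I → RightVectorSpace.Vec 𝔼 → TotallyOrderedDivisionRing.Carrier 𝕜) where
  open TotallyOrderedDivisionRing 𝕜
  open RightVectorSpace 𝔼
  open OrderedDivisionRingProperties 𝕜
  open Signs em
  open AffineFunctionalProperties 𝔼

  ⟪_⟫ : BoolExpr 𝔼 I → Vec → Set ℓ
  ⟪ e ⟫ = ⟦_⟧ 𝔼 e F Ω

  ⟪⟫⊆Ω : ∀ e {x} → ⟪ e ⟫ x → Ω x
  ⟪⟫⊆Ω (pos i) (Ωx , _) = Ωx
  ⟪⟫⊆Ω (neg i) (Ωx , _) = Ωx
  ⟪⟫⊆Ω (compl e) (Ωx , _) = Ωx
  ⟪⟫⊆Ω (union e₁ e₂) (inj₁ x∈e₁) = ⟪⟫⊆Ω e₁ x∈e₁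
  ⟪⟫⊆Ω (union e₁ e₂) (inj₂ x∈e₂) = ⟪⟫⊆Ω e₂ x∈e₂
  ⟪⟫⊆Ω (inter e₁ e₂) (x∈e₁ , _) = ⟪⟫⊆Ω e₁ x∈e₁

  indices : BoolExpr 𝔼 I → List I
  indices (pos i) = [ i ]
  indices (neg i) = [ i ]
  indices empty = []
  indices (compl e) = indices e
  indices (union e₁ e₂) = indices e₁ ++ indices e₂
  indices (inter e₁ e₂) = indices e₁ ++ indices e₂

  SignsAgree : List I → Vec → Vec → Set ℓ
  SignsAgree L x y = All (λ i → sign (F i x) ≡ sign (F i y)) L

  ⟪⟫-transfer : ∀ e {x y} → Ω y → SignsAgree (indices e) x y → ⟪ e ⟫ x → ⟪ e ⟫ y
  ⟪⟫-transfer (pos i) Ωy (agree ∷ []) (_ , 0<Fix) = Ωy , sign-transfer positive agree 0<Fix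
  ⟪⟫-transfer (neg i) Ωy (agree ∷ []) (_ , Fix<0) = Ωy , sign-transfer negative agree Fix<0
  ⟪⟫-transfer (compl e) Ωy agree (Ωx , x∉e) =
    Ωy , λ y∈e → x∉e (⟪⟫-transfer e Ωx (All.map sym agree) y∈e)
  ⟪⟫-transfer (union e₁ e₂) Ωy agree (inj₁ x∈e₁) = inj₁ (⟪⟫-transfer e₁ Ωy (++⁻ˡ (indices e₁) agree) x∈e₁)
  ⟪⟫-transfer (union e₁ e₂) Ωy agree (inj₂ x∈e₂) = inj₂ (⟪⟫-transfer e₂ Ωy (++⁻ʳ (indices e₁) agree) x∈e₂)
  ⟪⟫-transfer (inter e₁ e₂) Ωy agree (x∈e₁ , x∈e₂) =
    ⟪⟫-transfer e₁ Ωy (++⁻ˡ (indices e₁) agree) x∈e₁ , ⟪⟫-transfer e₂ Ωy (++⁻ʳ (indices e₁) agree) x∈e₂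

  signExpr : I → Sign → BoolExpr 𝔼 I
  signExpr i positive = pos i
  signExpr i negative = neg i
  signExpr i zero     = inter (compl (pos i)) (compl (neg i))

  ⟪signExpr⟫⁺ : ∀ i s {x} → Ω x → HasSign s (F i x) → ⟪ signExpr i s ⟫ x
  ⟪signExpr⟫⁺ i positive Ωx 0<Fix = Ωx , 0<Fix
  ⟪signExpr⟫⁺ i negative Ωx Fix<0 = Ωx , Fix<0
  ⟪signExpr⟫⁺ i zero     Ωx Fix≡0 =
    (Ωx , λ (_ , _ , 0≢Fix) → 0≢Fix (sym Fix≡0)) , (Ωx , λ (_ , _ , Fix≢0) → Fix≢0 Fix≡0)

  ⟪signExpr⟫⁻ : ∀ i s {x} → ⟪ signExpr i s ⟫ x → Ω x × HasSign s (F i x)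
  ⟪signExpr⟫⁻ i positive x∈e = x∈e
  ⟪signExpr⟫⁻ i negative x∈e = x∈e
  ⟪signExpr⟫⁻ i zero ((Ωx , Fix≯0) , (_ , Fix≮0)) =
    Ωx , neither-pos-nor-neg⇒zero (λ 0<Fix → Fix≯0 (Ωx , 0<Fix)) (λ Fix<0 → Fix≮0 (Ωx , Fix<0))

  Pattern : Set ℓ
  Pattern = List (I × Sign)

  HasPattern : Vec → Pattern → Set ℓ
  HasPattern x = All (λ (i , s) → HasSign s (F i x))

  atom : Pattern → BoolExpr 𝔼 I
  atom [] = compl empty
  atom ((i , s) ∷ σ) = inter (signExpr i s) (atom σ)

  ⟪atom⟫⁺ : ∀ {σ x} → Ω x → HasPattern x σ → ⟪ atom σ ⟫ x
  ⟪atom⟫⁺ Ωx [] = Ωx , λ ()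
  ⟪atom⟫⁺ {(i , s) ∷ σ} Ωx (hasSign ∷ hasPattern) = ⟪signExpr⟫⁺ i s Ωx hasSign , ⟪atom⟫⁺ Ωx hasPattern

  ⟪atom⟫⁻ : ∀ σ {x} → ⟪ atom σ ⟫ x → HasPattern x σ
  ⟪atom⟫⁻ [] _ = []
  ⟪atom⟫⁻ ((i , s) ∷ σ) (x∈signExpr , x∈atom) = proj₂ (⟪signExpr⟫⁻ i s x∈signExpr) ∷ ⟪atom⟫⁻ σ x∈atom

  atom-convex : IsConvex 𝔼 Ω → (∀ i → IsAffine 𝔼 (F i)) → ∀ σ → IsConvex 𝔼 ⟪ atom σ ⟫
  atom-convex Ω-convex F-affine [] x y t (Ωx , _) (Ωy , _) 0≤t t≤1 = Ω-convex x y t Ωx Ωy 0≤t t≤1 , λ ()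
  atom-convex Ω-convex F-affine ((i , s) ∷ σ) = ×-convex signExpr-convex (atom-convex Ω-convex F-affine σ)
    where
    signExpr-convex : IsConvex 𝔼 ⟪ signExpr i s ⟫
    signExpr-convex x y t x∈e y∈e 0≤t t≤1 =
      let Ωz , hasSign = signSet-convex s Ω-convex (F-affine i) x y t
                           (⟪signExpr⟫⁻ i s x∈e) (⟪signExpr⟫⁻ i s y∈e) 0≤t t≤1
      in ⟪signExpr⟫⁺ i s Ωz hasSign

  patterns : List I → List Pattern
  patterns [] = [ [] ]
  patterns (i ∷ L) = cartesianProductWith (λ s σ → (i , s) ∷ σ) (positive ∷ negative ∷ zero ∷ []) (patterns L)

  patternAt : List I → Vec → Pattern
  patternAt L x = map (λ i → i , sign (F i x)) L

  patternAt∈patterns : ∀ L x → patternAt L x ∈ patterns L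
  patternAt∈patterns [] x = here refl
  patternAt∈patterns (i ∷ L) x =
    ∈-cartesianProductWith⁺ (λ s σ → (i , s) ∷ σ) (sign∈signs (sign (F i x))) (patternAt∈patterns L x)
    where
    sign∈signs : ∀ s → s ∈ positive ∷ negative ∷ zero ∷ []
    sign∈signs positive = here refl
    sign∈signs negative = there (here refl)
    sign∈signs zero     = there (there (here refl))

  ∈-atom-patternAt : ∀ L {x} → Ω x → ⟪ atom (patternAt L x) ⟫ x
  ∈-atom-patternAt L {x} Ωx = ⟪atom⟫⁺ Ωx (All.map⁺ (All.universal (λ i → sign-correct (F i x)) L))

  atom-patternAt-agree : ∀ L {x y} → ⟪ atom (patternAt L x) ⟫ y → SignsAgree L x y
  atom-patternAt-agree L {x} y∈atom =
    All.map (λ hasSign → sym (sign-unique hasSign)) (All.map⁻ (⟪atom⟫⁻ (patternAt L x) y∈atom))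

  unionOfAtoms : List Pattern → BoolExpr 𝔼 I
  unionOfAtoms [] = empty
  unionOfAtoms (σ ∷ σs) = union (atom σ) (unionOfAtoms σs)

  ⟪unionOfAtoms⟫⁺ : ∀ {σ σs x} → σ ∈ σs → ⟪ atom σ ⟫ x → ⟪ unionOfAtoms σs ⟫ x
  ⟪unionOfAtoms⟫⁺ (here refl) x∈atom = inj₁ x∈atom
  ⟪unionOfAtoms⟫⁺ (there σ∈σs) x∈atom = inj₂ (⟪unionOfAtoms⟫⁺ σ∈σs x∈atom)

  ⟪unionOfAtoms⟫⁻ : ∀ σs {x} → ⟪ unionOfAtoms σs ⟫ x → ∃ λ σ → σ ∈ σs × ⟪ atom σ ⟫ x
  ⟪unionOfAtoms⟫⁻ (σ ∷ σs) (inj₁ x∈atom) = σ , here refl , x∈atom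
  ⟪unionOfAtoms⟫⁻ (σ ∷ σs) (inj₂ x∈union) =
    let τ , τ∈σs , x∈atom = ⟪unionOfAtoms⟫⁻ σs x∈union in τ , there τ∈σs , x∈atom

module Splitting {ℓ : Level} (em : ExcludedMiddle ℓ) {𝕜 : TotallyOrderedDivisionRing ℓ}
                 {𝔼 : RightVectorSpace 𝕜} {Ω : RightVectorSpace.Vec 𝔼 → Set ℓ} (Ω-convex : IsConvex 𝔼 Ω)
                 {I : Set ℓ} {F : I → RightVectorSpace.Vec 𝔼 → TotallyOrderedDivisionRing.Carrier 𝕜}
                 (F-affine : ∀ i → IsAffine 𝔼 (F i))
                 {a : RightVectorSpace.Vec 𝔼 → TotallyOrderedDivisionRing.Carrier 𝕜} (a-affine : IsAffine 𝔼 a)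
                 (e : BoolExpr 𝔼 I) (e⊆A± : _⊆_ 𝔼 (⟦_⟧ 𝔼 e F Ω) (_∪_ 𝔼 (PosSet 𝔼 a Ω) (NegSet 𝔼 a Ω))) where
  open TotallyOrderedDivisionRing 𝕜
  open RightVectorSpace 𝔼
  open AffineFunctionalProperties 𝔼
  open BoolExprProperties em 𝔼 Ω F

  atomOf : Vec → BoolExpr 𝔼 I
  atomOf x = atom (patternAt (indices e) x)

  atomOf-⊆ : ∀ {x y} → ⟪ e ⟫ x → ⟪ atomOf x ⟫ y → ⟪ e ⟫ y
  atomOf-⊆ {x} x∈e y∈atom =
    ⟪⟫-transfer e (⟪⟫⊆Ω (atomOf x) y∈atom) (atom-patternAt-agree (indices e) y∈atom) x∈e

  a≢0 : ∀ {x} → ⟪ e ⟫ x → a x ≢ 0#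
  a≢0 {x} x∈e = nonzero (e⊆A± x x∈e)
    where
    nonzero : _∪_ 𝔼 (PosSet 𝔼 a Ω) (NegSet 𝔼 a Ω) x → a x ≢ 0#
    nonzero (inj₁ (_ , _ , 0≢ax)) ax≡0 = 0≢ax (sym ax≡0)
    nonzero (inj₂ (_ , _ , ax≢0))      = ax≢0

  atomOf-no-sign-change : ∀ {x y z} → ⟪ e ⟫ x → ⟪ atomOf x ⟫ y → ⟪ atomOf x ⟫ z → 0# < a y → a z < 0# → ⊥
  atomOf-no-sign-change {x} x∈e =
    affine-no-sign-change a-affine (atom-convex Ω-convex F-affine (patternAt (indices e) x))
      (λ w∈atom → a≢0 (atomOf-⊆ x∈e w∈atom))

  Witnessed : (Carrier → Set ℓ) → Pattern → Set ℓ
  Witnessed Q σ = ∃ λ x → ⟪ e ⟫ x × Q (a x) × σ ≡ patternAt (indices e) x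

  witnessed? : ∀ Q → Decidable (Witnessed Q)
  witnessed? Q σ = em

  part : (Carrier → Set ℓ) → BoolExpr 𝔼 I
  part Q = unionOfAtoms (filter (witnessed? Q) (patterns (indices e)))

  part⁺ : ∀ Q {x} → ⟪ e ⟫ x → Q (a x) → ⟪ part Q ⟫ x
  part⁺ Q {x} x∈e Qax =
    ⟪unionOfAtoms⟫⁺ (∈-filter⁺ (witnessed? Q) (patternAt∈patterns (indices e) x) (x , x∈e , Qax , refl))
                    (∈-atom-patternAt (indices e) (⟪⟫⊆Ω e x∈e))

  part⁻ : ∀ Q {y} → ⟪ part Q ⟫ y → ∃ λ x → ⟪ e ⟫ x × Q (a x) × ⟪ atomOf x ⟫ y
  part⁻ Q y∈part with ⟪unionOfAtoms⟫⁻ _ y∈part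
  ... | σ , σ∈filter , y∈atom with ∈-filter⁻ (witnessed? Q) {xs = patterns (indices e)} σ∈filter
  ...   | _ , x , x∈e , Qax , refl = x , x∈e , Qax , y∈atom

  e≐parts : _≐_ 𝔼 ⟪ e ⟫ (_∪_ 𝔼 ⟪ part (0# <_) ⟫ ⟪ part (_< 0#) ⟫)
  e≐parts x = split , merge
    where
    split : ⟪ e ⟫ x → ⟪ part (0# <_) ⟫ x ⊎ ⟪ part (_< 0#) ⟫ x
    split x∈e with e⊆A± x x∈e
    ... | inj₁ (_ , 0<ax) = inj₁ (part⁺ (0# <_) x∈e 0<ax)
    ... | inj₂ (_ , ax<0) = inj₂ (part⁺ (_< 0#) x∈e ax<0)
    merge : ⟪ part (0# <_) ⟫ x ⊎ ⟪ part (_< 0#) ⟫ x → ⟪ e ⟫ x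
    merge (inj₁ x∈part) = let _ , w∈e , _ , x∈atom = part⁻ (0# <_) x∈part in atomOf-⊆ w∈e x∈atom
    merge (inj₂ x∈part) = let _ , w∈e , _ , x∈atom = part⁻ (_< 0#) x∈part in atomOf-⊆ w∈e x∈atom

  part-pos⊆A⁺ : _⊆_ 𝔼 ⟪ part (0# <_) ⟫ (PosSet 𝔼 a Ω)
  part-pos⊆A⁺ y y∈part with part⁻ (0# <_) y∈part
  ... | x , x∈e , 0<ax , y∈atom with e⊆A± y (atomOf-⊆ x∈e y∈atom)
  ...   | inj₁ y∈A⁺ = y∈A⁺
  ...   | inj₂ (_ , ay<0) =
    ⊥-elim (atomOf-no-sign-change x∈e (∈-atom-patternAt (indices e) (⟪⟫⊆Ω e x∈e)) y∈atom 0<ax ay<0)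

  part-neg⊆A⁻ : _⊆_ 𝔼 ⟪ part (_< 0#) ⟫ (NegSet 𝔼 a Ω)
  part-neg⊆A⁻ y y∈part with part⁻ (_< 0#) y∈part
  ... | x , x∈e , ax<0 , y∈atom with e⊆A± y (atomOf-⊆ x∈e y∈atom)
  ...   | inj₂ y∈A⁻ = y∈A⁻
  ...   | inj₁ (_ , 0<ay) =
    ⊥-elim (atomOf-no-sign-change x∈e y∈atom (∈-atom-patternAt (indices e) (⟪⟫⊆Ω e x∈e)) 0<ay ax<0)

lemma5p1 : {ℓ : Level} → ExcludedMiddle ℓ → (𝕜 : TotallyOrderedDivisionRing ℓ) → (𝔼 : RightVectorSpace 𝕜) → (Ω : RightVectorSpace.Vec 𝔼 → Set ℓ) → IsConvex 𝔼 Ω → (I : Set ℓ) → (F : I → RightVectorSpace.Vec 𝔼 → TotallyOrderedDivisionRing.Carrier 𝕜) → (∀ i → IsAffine 𝔼 (F i)) → (a : RightVectorSpace.Vec 𝔼 → TotallyOrderedDivisionRing.Carrier 𝕜) → IsAffine 𝔼 a → (U : RightVectorSpace.Vec 𝔼 → Set ℓ) → InBool 𝔼 F Ω U → _⊆_ 𝔼 U (_∪_ 𝔼 (PosSet 𝔼 a Ω) (NegSet 𝔼 a Ω))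
    → Σ (RightVectorSpace.Vec 𝔼 → Set ℓ) (λ U⁺ → Σ (RightVectorSpace.Vec 𝔼 → Set ℓ) (λ U⁻ → InBool 𝔼 F Ω U⁺ × InBool 𝔼 F Ω U⁻ × _≐_ 𝔼 U (_∪_ 𝔼 U⁺ U⁻) × _⊆_ 𝔼 U⁺ (PosSet 𝔼 a Ω) × _⊆_ 𝔼 U⁻ (NegSet 𝔼 a Ω)))
lemma5p1 em 𝕜 𝔼 Ω Ω-convex I F F-affine a a-affine U (e , U≐e) U⊆A± =
  ⟪ part (0# <_) ⟫ , ⟪ part (_< 0#) ⟫ ,
  (part (0# <_) , λ _ → id , id) , (part (_< 0#) , λ _ → id , id) ,
  (λ x → e≐parts x .proj₁ ∘ U≐e x .proj₁ , U≐e x .proj₂ ∘ e≐parts x .proj₂) ,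
  part-pos⊆A⁺ , part-neg⊆A⁻
  where
  open TotallyOrderedDivisionRing 𝕜 using (0#; _<_)
  open BoolExprProperties em 𝔼 Ω F using (⟪_⟫)
  open Splitting em Ω-convex F-affine a-affine e (λ x x∈e → U⊆A± x (U≐e x .proj₂ x∈e))
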